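{- Let $D$ be the $q$-derivative of the $q$-grammar $G_{\tan\cup\sec}$. For every $n\ge3$, every word appearing with nonzero coefficient in $D^n(x_0)$ is of exactly one of the following forms: (i) $x_nx_{n-1}^{\,n}$; (ii) $x_1^{\,n}x_0$; (iii) $x_{j+1}^{\,a}x_j^{\,b}$ with $a,b\le n$, $1\le j\le n-2$, $a+b\le n+1$ and $a+b+n+1$ even. (Here $x_i^a$ denotes the letter $x_i$ repeated $a$ times.)
   Context: Let $\mathbb{K}$ be a commutative ring with unity of characteristic zero and $q$ an indeterminate. Master variables $S=\{x,y\}$, variables $x_i,y_i$ ($i\ge0$), $\mathbb{S}$ the set of these; $\mathbb{E}=\mathbb{K}[q][F(\mathbb{S})]$ is the group algebra of the free group on $\mathbb{S}$. The rule $R$ is $R(x_j)=q^j(1+x_jx_{j+1})$, $R(y_j)=q^jx_jy_{j+1}$, extended to inverses by $R(s_i^{ -1})=-s_i^{ -1}R(s_i)s_{i+1}^{ -1}$. $\uparrow$ is the $\mathbb{K}[q]$-linear map replacing each letter $s_i^{\pm1}$ by $s_{i+1}^{\pm1}$. The order DIO rewrites a word by stably sorting its letters according to the total order $\cdots<x_2<y_2<x_1<y_1<x_0<y_0$ (a letter $s_i^{ -1}$ ranked as $s_i$), extended linearly. $G_{\tan\cup\sec}=(\{x,y\},R,\mathrm{DIO})$ and its $q$-derivative is the $\mathbb{K}[q]$-linear map $D(w_1\cdots w_n)=\sum_{j=1}^n\mathrm{DIO}\big(w_1\cdots w_{j-1}R(w_j)\uparrow(w_{j+1}\cdots w_n)\big)$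 for letters $w_j$; $D^n$ is its $n$-th iterate. -}

module Defs where

open import Level using (Level)
open import Data.Bool using (Bool; true; false; _∧_; _∨_; if_then_else_; not)
open import Data.Nat using (ℕ; zero; suc; _+_; _∸_; _≤_; _<ᵇ_; _≡ᵇ_)
open import Data.Nat.Divisibility using (_∣_)
open import Data.List using (List; []; _∷_; _++_; map; concatMap; foldr; replicate; reverse)
open import Data.Product using (_×_; _,_; Σ; ∃; ∃-syntax)
open import Data.Sum using (_⊎_)
open import Relation.Nullary using (¬_)
open import Relation.Binary.PropositionalEquality using (_≡_)
open import Algebra.Bundles using (CommutativeRing)

-- Letters s_i^{±1} of the free group F(𝕊), 𝕊 = {x_i, y_i : i ≥ 0}

data Var : Set where
  X Y : Var

record Letter : Set where
  constructor mkL
  field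
    var : Var
    idx : ℕ
    pos : Bool      -- true: s_i ; false: s_i^{-1}
open Letter public

-- group elements = freely reduced words (lists of letters)
Word : Set
Word = List Letter

x : ℕ → Letter
x i = mkL X i true

isX : Letter → Bool
isX l with var l
... | X = true
... | Y = false

isY : Letter → Bool
isY l = not (isX l)

_==V_ : Var → Var → Bool
X ==V X = true
Y ==V Y = true
_ ==V _ = false

_==B_ : Bool → Bool → Bool
true ==B true = true
false ==B false = true
_ ==B _ = false

_==L_ : Letter → Letter → Bool
a ==L b = (var a ==V var b) ∧ ((idx a ≡ᵇ idx b) ∧ (pos a ==B pos b))

_==W_ : Word → Word → Bool
[] ==W [] = true
(a ∷ as) ==W (b ∷ bs) = (a ==L b) ∧ (as ==W bs)
_ ==W _ = false

invPair : Letter → Letter → Bool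
invPair a b = (var a ==V var b) ∧ ((idx a ≡ᵇ idx b) ∧ not (pos a ==B pos b))

push : Letter → Word → Word
push a [] = a ∷ []
push a (b ∷ bs) = if invPair a b then bs else a ∷ b ∷ bs

reduce : Word → Word
reduce = foldr push []

_·_ : Word → Word → Word
u · v = reduce (u ++ v)

inv : Letter → Letter
inv (mkL v i p) = mkL v i (not p)

shiftL : Letter → Letter
shiftL (mkL v i p) = mkL v (suc i) p

shiftW : Word → Word
shiftW = map shiftL

-- The order DIO: stable sort w.r.t.  ⋯ < x_2 < y_2 < x_1 < y_1 < x_0 < y_0
-- (s_i^{-1} ranked as s_i), then read the result in the free group.

_≺_ : Letter → Letter → Bool
a ≺ b = (idx b <ᵇ idx a) ∨ ((idx a ≡ᵇ idx b) ∧ (isX a ∧ isY b))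

insert : Letter → Word → Word
insert a [] = a ∷ []
insert a (b ∷ bs) = if b ≺ a then b ∷ insert a bs else a ∷ b ∷ bs

stableSort : Word → Word
stableSort [] = []
stableSort (a ∷ as) = insert a (stableSort as)

DIO : Word → Word
DIO w = reduce (stableSort w)

-- The algebra 𝔼 = 𝕂[q][F(𝕊)], parametrised by the commutative ring 𝕂.
-- An element is a finite formal sum of terms  c · q^k · w  (c ∈ 𝕂).

module Alg {c ℓ : Level} (K : CommutativeRing c ℓ) where
  open CommutativeRing K renaming (Carrier to 𝕂; _+_ to _+ₖ_; _*_ to _*ₖ_; -_ to -ₖ_)

  record Term : Set c where
    constructor tm
    field
      coef : 𝕂
      qdeg : ℕ
      word : Word
  open Term public

  𝔼 : Set c
  𝔼 = List Term

  natK : ℕ → 𝕂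
  natK zero = 0#
  natK (suc n) = 1# +ₖ natK n

  CharZero : Set ℓ
  CharZero = ∀ m → ¬ (natK (suc m) ≈ 0#)

  coeff : ℕ → Word → 𝔼 → 𝕂
  coeff k w [] = 0#
  coeff k w (tm a j u ∷ ts) =
    if (j ≡ᵇ k) ∧ (u ==W w) then a +ₖ coeff k w ts else coeff k w ts

  Appears : Word → 𝔼 → Set ℓ
  Appears w e = ∃[ k ] ¬ (coeff k w e ≈ 0#)

  R⁺ : Var → ℕ → 𝔼
  R⁺ X j = tm 1# j [] ∷ tm 1# j (x j ∷ x (suc j) ∷ []) ∷ []
  R⁺ Y j = tm 1# j (x j ∷ mkL Y (suc j) true ∷ []) ∷ []

  R : Letter → 𝔼
  R (mkL v j true) = R⁺ v j
  R (mkL v j false) =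
    map (λ t → tm (-ₖ coef t) (qdeg t)
                  (((mkL v j false ∷ []) · word t) · (mkL v (suc j) false ∷ [])))
        (R⁺ v j)

  Dword : Word → Word → 𝔼
  Dword pre [] = []
  Dword pre (a ∷ suf) =
    map (λ t → tm (coef t) (qdeg t) (DIO ((pre · word t) · shiftW suf))) (R a)
    ++ Dword (pre ++ (a ∷ [])) suf

  D : 𝔼 → 𝔼
  D = concatMap (λ t → map (λ s → tm (coef t *ₖ coef s) (qdeg t + qdeg s) (word s))
                           (Dword [] (word t)))

  D^ : ℕ → 𝔼 → 𝔼
  D^ zero e = e
  D^ (suc n) e = D (D^ n e)

  x₀ : 𝔼
  x₀ = tm 1# 0 (x 0 ∷ []) ∷ []

FormI : ℕ → Word → Set
FormI n w = w ≡ x n ∷ replicate n (x (n ∸ 1))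

FormII : ℕ → Word → Set
FormII n w = w ≡ replicate n (x 1) ++ (x 0 ∷ [])

FormIII : ℕ → Word → Set
FormIII n w = ∃[ a ] ∃[ b ] ∃[ j ]
  (a ≤ n × b ≤ n × 1 ≤ j × j ≤ n ∸ 2 × a + b ≤ suc n × 2 ∣ (a + b + suc n)
   × w ≡ replicate a (x (suc j)) ++ replicate b (x j))

ExactlyOne : ℕ → Word → Set
ExactlyOne n w =
  (FormI n w ⊎ FormII n w ⊎ FormIII n w)
  × ¬ (FormI n w × FormII n w)
  × ¬ (FormI n w × FormIII n w)
  × ¬ (FormII n w × FormIII n w)

-- Every word occurring in D^n(x₀) (n ≥ 3) is a two-block word x_{k+1}^a x_k^b with
-- positive letters only.  Differentiating one letter of such a word and sorting by DIO
-- gives again a two-block word: the differentiated letter is replaced by 1 or by the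
-- pair x_k x_{k+1} and the letters after it are shifted up by one, so the number of
-- letters changes by exactly one.  Hence the three forms are closed under D, because
-- the conditions in (iii) only involve the index range, the total number of letters
-- and its parity; the degenerate children x_n^n and x_1^n of (i) and (ii) fall into (iii)
-- again.  The base case D³(x₀) is a direct computation.
module Submission where

open import Defs
open import Level using (Level)
open import Algebra.Bundles using (CommutativeRing)
open import Data.Bool using (true; false; _∧_; T)
open import Data.Bool.Properties using (∧-zeroʳ; ∨-identityʳ)
open import Data.Nat using (ℕ; zero; suc; _+_; _*_; _∸_; _≤_; _≤?_; _<ᵇ_; _≡ᵇ_; z≤n; s≤s)
open import Data.Nat.Properties
  using (+-identityʳ; +-suc; +-comm; ≤-refl; ≤-trans; n≤1+n; m≤m+n; m≤n+m; ≡ᵇ⇒≡; 1+n≰n)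
open import Data.Nat.Divisibility using (_∣_; divides; ∣m∣n⇒∣m+n; ∣-refl; _∣?_)
open import Data.Nat.Tactic.RingSolver using (solve-∀)
open import Data.List using ([]; _∷_; _++_; replicate)
open import Data.List.Properties using (++-identityʳ)
open import Data.List.Relation.Unary.All as All using (All; []; _∷_)
open import Data.List.Relation.Unary.All.Properties using (++⁺; ++⁻ʳ; map⁺; concat⁺; replicate⁺)
open import Data.List.Relation.Unary.Any using (Any; here; there)
open import Data.Product using (_×_; _,_)
open import Data.Sum using (_⊎_; inj₁; inj₂)
open import Data.Unit using (tt)
open import Data.Empty using (⊥-elim)
open import Function using (_∘_)
open import Relation.Nullary using (¬_)
open import Relation.Nullary.Decidable using (True; toWitness)
open import Relation.Binary.PropositionalEquality

twoBlock : ℕ → ℕ → ℕ → Word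
twoBlock k a b = replicate a (x (suc k)) ++ replicate b (x k)

twoBlock-indices : ∀ k a b → All (λ l → k ≤ idx l × idx l ≤ suc k) (twoBlock k a b)
twoBlock-indices k a b = ++⁺ (replicate⁺ a (n≤1+n k , ≤-refl)) (replicate⁺ b (≤-refl , n≤1+n k))

twoBlock-no-low : ∀ k a → twoBlock (suc k) 0 a ≡ twoBlock k a 0
twoBlock-no-low k a = sym (++-identityʳ (replicate a (x (suc k))))

twoBlock-snoc-high : ∀ k i → twoBlock k i 0 ++ x (suc k) ∷ [] ≡ twoBlock k (suc i) 0
twoBlock-snoc-high k zero = refl
twoBlock-snoc-high k (suc i) = cong (x (suc k) ∷_) (twoBlock-snoc-high k i)

twoBlock-snoc-low : ∀ k a i → twoBlock k a i ++ x k ∷ [] ≡ twoBlock k a (suc i)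
twoBlock-snoc-low k (suc a) i = cong (x (suc k) ∷_) (twoBlock-snoc-low k a i)
twoBlock-snoc-low k zero zero = refl
twoBlock-snoc-low k zero (suc i) = cong (x k ∷_) (twoBlock-snoc-low k zero i)

data Shuffle (k : ℕ) : ℕ → ℕ → Word → Set where
  []   : Shuffle k 0 0 []
  high : ∀ {a b w} → Shuffle k a b w → Shuffle k (suc a) b (x (suc k) ∷ w)
  low  : ∀ {a b w} → Shuffle k a b w → Shuffle k a (suc b) (x k ∷ w)

Shuffle-++ : ∀ {k a b c d u v} → Shuffle k a b u → Shuffle k c d v → Shuffle k (a + c) (b + d) (u ++ v)
Shuffle-++ [] q = q
Shuffle-++ (high p) q = high (Shuffle-++ p q)
Shuffle-++ (low p) q = low (Shuffle-++ p q)

twoBlock-Shuffle : ∀ k a b → Shuffle k a b (twoBlock k a b)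
twoBlock-Shuffle k (suc a) b = high (twoBlock-Shuffle k a b)
twoBlock-Shuffle k zero zero = []
twoBlock-Shuffle k zero (suc b) = low (twoBlock-Shuffle k zero b)

highs-Shuffle : ∀ k i → Shuffle (suc k) 0 i (twoBlock k i 0)
highs-Shuffle k zero = []
highs-Shuffle k (suc i) = low (highs-Shuffle k i)

shiftW-Shuffle : ∀ {k a b w} → Shuffle k a b w → Shuffle (suc k) a b (shiftW w)
shiftW-Shuffle [] = []
shiftW-Shuffle (high p) = high (shiftW-Shuffle p)
shiftW-Shuffle (low p) = low (shiftW-Shuffle p)

shiftW-lows-Shuffle : ∀ k m → Shuffle k m 0 (shiftW (replicate m (x k)))
shiftW-lows-Shuffle k zero = []
shiftW-lows-Shuffle k (suc m) = high (shiftW-lows-Shuffle k m)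

push-positive : ∀ i j w → push (x i) (x j ∷ w) ≡ x i ∷ x j ∷ w
push-positive i j w rewrite ∧-zeroʳ (i ≡ᵇ j) = refl

push-Shuffle : ∀ {k a b w} → Shuffle k a b w → ∀ i → push (x i) w ≡ x i ∷ w
push-Shuffle [] i = refl
push-Shuffle (high {w = w} _) i = push-positive i _ w
push-Shuffle (low {w = w} _) i = push-positive i _ w

reduce-Shuffle : ∀ {k a b w} → Shuffle k a b w → reduce w ≡ w
reduce-Shuffle [] = refl
reduce-Shuffle (high p) = trans (cong (push _) (reduce-Shuffle p)) (push-Shuffle p _)
reduce-Shuffle (low p) = trans (cong (push _) (reduce-Shuffle p)) (push-Shuffle p _)

<ᵇ-irrefl : ∀ n → (n <ᵇ n) ≡ false
<ᵇ-irrefl zero = refl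
<ᵇ-irrefl (suc n) = <ᵇ-irrefl n

<ᵇ-suc : ∀ n → (n <ᵇ suc n) ≡ true
<ᵇ-suc zero = refl
<ᵇ-suc (suc n) = <ᵇ-suc n

suc-<ᵇ : ∀ n → (suc n <ᵇ n) ≡ false
suc-<ᵇ zero = refl
suc-<ᵇ (suc n) = suc-<ᵇ n

x≺x : ∀ i j → (x i ≺ x j) ≡ (j <ᵇ i)
x≺x i j rewrite ∧-zeroʳ (i ≡ᵇ j) = ∨-identityʳ (j <ᵇ i)

insert-high : ∀ k a b → insert (x (suc k)) (twoBlock k a b) ≡ twoBlock k (suc a) b
insert-high k (suc a) b rewrite x≺x (suc k) (suc k) | <ᵇ-irrefl (suc k) = refl
insert-high k zero zero = refl
insert-high k zero (suc b) rewrite x≺x k (suc k) | suc-<ᵇ k = refl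

insert-low : ∀ k a b → insert (x k) (twoBlock k a b) ≡ twoBlock k a (suc b)
insert-low k (suc a) b rewrite x≺x (suc k) k | <ᵇ-suc k = cong (x (suc k) ∷_) (insert-low k a b)
insert-low k zero zero = refl
insert-low k zero (suc b) rewrite x≺x k k | <ᵇ-irrefl k = refl

stableSort-Shuffle : ∀ {k a b w} → Shuffle k a b w → stableSort w ≡ twoBlock k a b
stableSort-Shuffle [] = refl
stableSort-Shuffle {k} (high {a} {b} p) rewrite stableSort-Shuffle p = insert-high k a b
stableSort-Shuffle {k} (low {a} {b} p) rewrite stableSort-Shuffle p = insert-low k a b

DIO-Shuffle : ∀ {k a b w} → Shuffle k a b w → DIO w ≡ twoBlock k a b
DIO-Shuffle {k} {a} {b} p rewrite stableSort-Shuffle p = reduce-Shuffle (twoBlock-Shuffle k a b)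

·-Shuffle : ∀ {k a b c d u v} → Shuffle k a b u → Shuffle k c d v → u · v ≡ u ++ v
·-Shuffle p q = reduce-Shuffle (Shuffle-++ p q)

-- The words of D(twoBlock k a b): R is applied to a letter x_j with i letters of its
-- block before it and m after it, taking the term 1 (-one) or x_j x_{j+1} (-pair).
data Child (k a b : ℕ) : Word → Set where
  high-one  : ∀ i m → suc (i + m) ≡ a → Child k a b (twoBlock (suc k) m (i + b))
  high-pair : ∀ i m → suc (i + m) ≡ a → Child k a b (twoBlock (suc k) (suc m) (suc (i + b)))
  low-one   : ∀ i m → suc (i + m) ≡ b → Child k a b (twoBlock k (a + m) i)
  low-pair  : ∀ i m → suc (i + m) ≡ b → Child k a b (twoBlock k (suc (a + m)) (suc i))

Forms : ℕ → Word → Set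
Forms n w = FormI n w ⊎ FormII n w ⊎ FormIII n w

Admissible : ℕ → ℕ → Set
Admissible n s = s ≤ suc n × 2 ∣ s + suc n

Admissible-suc : ∀ n → Admissible n (suc n)
Admissible-suc n = ≤-refl , divides (suc n) (double (suc n))
  where
    double : ∀ m → m + m ≡ m * 2
    double = solve-∀

Admissible-+1 : ∀ n → Admissible n (n + 1)
Admissible-+1 n = subst (Admissible n) (+-comm 1 n) (Admissible-suc n)

FormIII-one : ∀ {n} j a b → Admissible n (suc (a + b)) → 1 ≤ j → j ≤ n ∸ 1
  → FormIII (suc n) (twoBlock j a b)
FormIII-one {n} j a b (s≤s a+b≤n , even) 1≤j j≤n-1 =
  a , b , j , ≤-trans (m≤m+n a b) a+b≤1+n , ≤-trans (m≤n+m b a) a+b≤1+n , 1≤j , j≤n-1 ,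
  ≤-trans a+b≤1+n (n≤1+n (suc n)) , subst (2 ∣_) (sym (+-suc (a + b) (suc n))) even , refl
  where
    a+b≤1+n : a + b ≤ suc n
    a+b≤1+n = ≤-trans a+b≤n (n≤1+n n)

FormIII-pair : ∀ {n} j a b → Admissible n (a + suc b) → 1 ≤ j → j ≤ n ∸ 1
  → FormIII (suc n) (twoBlock j (suc a) (suc b))
FormIII-pair {n} j a b (s≤1+n , even) 1≤j j≤n-1 =
  suc a , suc b , j , ≤-trans (subst (suc a ≤_) (sym (+-suc a b)) (m≤m+n (suc a) b)) s≤1+n ,
  ≤-trans (m≤n+m (suc b) a) s≤1+n , 1≤j , j≤n-1 , s≤s s≤1+n ,
  subst (2 ∣_) (sym (cong suc (+-suc (a + suc b) (suc n)))) (∣m∣n⇒∣m+n ∣-refl even) , refl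

high-one-size : ∀ i m b {a} → suc (i + m) ≡ a → a + b ≡ suc (m + (i + b))
high-one-size i m b refl = lemma i m b
  where
    lemma : ∀ i m b → suc (i + m) + b ≡ suc (m + (i + b))
    lemma = solve-∀

high-pair-size : ∀ i m b {a} → suc (i + m) ≡ a → a + b ≡ m + suc (i + b)
high-pair-size i m b refl = lemma i m b
  where
    lemma : ∀ i m b → suc (i + m) + b ≡ m + suc (i + b)
    lemma = solve-∀

low-one-size : ∀ a i m {b} → suc (i + m) ≡ b → a + b ≡ suc (a + m + i)
low-one-size a i m refl = lemma a i m
  where
    lemma : ∀ a i m → a + suc (i + m) ≡ suc (a + m + i)
    lemma = solve-∀

low-pair-size : ∀ a i m {b} → suc (i + m) ≡ b → a + b ≡ a + m + suc i
low-pair-size a i m refl = lemma a i m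
  where
    lemma : ∀ a i m → a + suc (i + m) ≡ a + m + suc i
    lemma = solve-∀

FormI-children : ∀ p {w} → Child (suc p) 1 (2 + p) w → Forms (3 + p) w
FormI-children p (high-one zero zero refl) =
  inj₂ (inj₂ (subst (FormIII (3 + p)) (sym (twoBlock-no-low (suc p) (2 + p)))
                    (FormIII-one (suc p) (2 + p) 0 admissible (s≤s z≤n) ≤-refl)))
  where
    admissible : Admissible (2 + p) (suc (2 + p + 0))
    admissible =
      subst (λ s → Admissible (2 + p) (suc s)) (sym (+-identityʳ (2 + p))) (Admissible-suc (2 + p))
FormI-children p (high-pair zero zero refl) = inj₁ refl
FormI-children p (low-one i m e) =
  inj₂ (inj₂ (FormIII-one (suc p) (suc m) i
                (subst (Admissible (2 + p)) (low-one-size 1 i m e) (Admissible-suc (2 + p)))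
                (s≤s z≤n) ≤-refl))
FormI-children p (low-pair i m e) =
  inj₂ (inj₂ (FormIII-pair (suc p) (suc m) i
                (subst (Admissible (2 + p)) (low-pair-size 1 i m e) (Admissible-suc (2 + p)))
                (s≤s z≤n) ≤-refl))

FormII-children : ∀ p {w} → Child 0 (2 + p) 1 w → Forms (3 + p) w
FormII-children p (high-one i m e) =
  inj₂ (inj₂ (FormIII-one 1 m (i + 1)
                (subst (Admissible (2 + p)) (high-one-size i m 1 e) (Admissible-+1 (2 + p)))
                (s≤s z≤n) (s≤s z≤n)))
FormII-children p (high-pair i m e) =
  inj₂ (inj₂ (FormIII-pair 1 m (i + 1)
                (subst (Admissible (2 + p)) (high-pair-size i m 1 e) (Admissible-+1 (2 + p)))
                (s≤s z≤n) (s≤s z≤n)))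
FormII-children p (low-one zero zero refl) =
  inj₂ (inj₂ (subst (FormIII (3 + p)) (sym x₁-power)
                    (FormIII-one 1 0 (2 + p) (Admissible-suc (2 + p)) (s≤s z≤n) (s≤s z≤n))))
  where
    x₁-power : twoBlock 0 (2 + p + 0) 0 ≡ twoBlock 1 0 (2 + p)
    x₁-power =
      trans (cong (λ a → twoBlock 0 a 0) (+-identityʳ (2 + p))) (sym (twoBlock-no-low 0 (2 + p)))
FormII-children p (low-pair zero zero refl) =
  inj₂ (inj₁ (cong (λ a → twoBlock 0 (suc a) 1) (+-identityʳ (2 + p))))

FormIII-children : ∀ {p} j a b {w} → Admissible (2 + p) (a + b) → 1 ≤ j → j ≤ p
  → Child j a b w → Forms (3 + p) w
FormIII-children j a b adm 1≤j j≤p (high-one i m e) =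
  inj₂ (inj₂ (FormIII-one (suc j) m (i + b)
                (subst (Admissible _) (high-one-size i m b e) adm) (s≤s z≤n) (s≤s j≤p)))
FormIII-children j a b adm 1≤j j≤p (high-pair i m e) =
  inj₂ (inj₂ (FormIII-pair (suc j) m (i + b)
                (subst (Admissible _) (high-pair-size i m b e) adm) (s≤s z≤n) (s≤s j≤p)))
FormIII-children {p} j a b adm 1≤j j≤p (low-one i m e) =
  inj₂ (inj₂ (FormIII-one j (a + m) i
                (subst (Admissible _) (low-one-size a i m e) adm) 1≤j (≤-trans j≤p (n≤1+n p))))
FormIII-children {p} j a b adm 1≤j j≤p (low-pair i m e) =
  inj₂ (inj₂ (FormIII-pair j (a + m) i
                (subst (Admissible _) (low-pair-size a i m e) adm) 1≤j (≤-trans j≤p (n≤1+n p))))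

∧-true : ∀ {a b} → (a ∧ b) ≡ true → a ≡ true × b ≡ true
∧-true {true} {true} _ = refl , refl

==V-sound : ∀ u v → (u ==V v) ≡ true → u ≡ v
==V-sound X X _ = refl
==V-sound Y Y _ = refl

==B-sound : ∀ u v → (u ==B v) ≡ true → u ≡ v
==B-sound true true _ = refl
==B-sound false false _ = refl

≡ᵇ-sound : ∀ m n → (m ≡ᵇ n) ≡ true → m ≡ n
≡ᵇ-sound m n e = ≡ᵇ⇒≡ m n (subst T (sym e) tt)

==L-sound : ∀ a b → (a ==L b) ≡ true → a ≡ b
==L-sound (mkL v i p) (mkL v′ i′ p′) e with ∧-true {v ==V v′} e
... | v≡v′ , rest with ∧-true {i ≡ᵇ i′} rest
... | i≡i′ , p≡p′ with ==V-sound v v′ v≡v′ | ≡ᵇ-sound i i′ i≡i′ | ==B-sound p p′ p≡p′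
... | refl | refl | refl = refl

==W-sound : ∀ u w → (u ==W w) ≡ true → u ≡ w
==W-sound [] [] _ = refl
==W-sound (a ∷ u) (b ∷ w) e with ∧-true {a ==L b} e
... | a≡b , u≡w = cong₂ _∷_ (==L-sound a b a≡b) (==W-sound u w u≡w)

Forms⇒ExactlyOne : ∀ m w → Forms (2 + m) w → ExactlyOne (2 + m) w
Forms⇒ExactlyOne m w forms = forms , not-I-II , not-I-III , not-II-III
  where
    not-I-II : ¬ (FormI (2 + m) w × FormII (2 + m) w)
    not-I-II (refl , ())
    not-I-III : ¬ (FormI (2 + m) w × FormIII (2 + m) w)
    not-I-III (refl , (a , b , j , _ , _ , _ , j≤m , _ , _ , e))
      with subst (All _) (sym e) (twoBlock-indices j a b)
    ... | (_ , s≤s 1+m≤j) ∷ _ = 1+n≰n (≤-trans 1+m≤j j≤m)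
    not-II-III : ¬ (FormII (2 + m) w × FormIII (2 + m) w)
    not-II-III (refl , (a , b , j , _ , _ , 1≤j , _ , _ , _ , e))
      with ++⁻ʳ (replicate (2 + m) (x 1)) (subst (All _) (sym e) (twoBlock-indices j a b))
    ... | (j≤0 , _) ∷ _ with ≤-trans 1≤j j≤0
    ... | ()

module Derivative {c ℓ : Level} (K : CommutativeRing c ℓ) where
  open Alg K
  open CommutativeRing K using (1#; 0#; _≈_) renaming (refl to ≈-refl)

  Dword-step : ∀ {k a b c d pre suf} → Shuffle k a b pre → Shuffle k c d (shiftW suf)
    → Dword pre (x k ∷ suf)
      ≡ tm 1# k (twoBlock k (a + c) (b + d))
        ∷ tm 1# k (twoBlock k (suc (a + c)) (suc (b + d)))
        ∷ Dword (pre ++ x k ∷ []) suf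
  Dword-step {k} {a} {b} {c} {d} {pre} {suf} p q =
    cong₂ (λ u v → tm 1# k u ∷ tm 1# k v ∷ Dword (pre ++ x k ∷ []) suf) by-one by-pair
    where
      open ≡-Reasoning
      pair : Word
      pair = x k ∷ x (suc k) ∷ []
      pair-Shuffle : Shuffle k 1 1 pair
      pair-Shuffle = low (high [])
      one-plus : ∀ m n → m + 1 + n ≡ suc (m + n)
      one-plus m n = cong (_+ n) (+-comm m 1)
      by-one : DIO ((pre · []) · shiftW suf) ≡ twoBlock k (a + c) (b + d)
      by-one = begin
        DIO ((pre · []) · shiftW suf)
          ≡⟨ cong (λ u → DIO (reduce u · shiftW suf)) (++-identityʳ pre) ⟩
        DIO (reduce pre · shiftW suf)
          ≡⟨ cong (λ u → DIO (u · shiftW suf)) (reduce-Shuffle p) ⟩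
        DIO (pre · shiftW suf)
          ≡⟨ cong DIO (·-Shuffle p q) ⟩
        DIO (pre ++ shiftW suf)
          ≡⟨ DIO-Shuffle (Shuffle-++ p q) ⟩
        twoBlock k (a + c) (b + d)
          ∎
      by-pair : DIO ((pre · pair) · shiftW suf) ≡ twoBlock k (suc (a + c)) (suc (b + d))
      by-pair = begin
        DIO ((pre · pair) · shiftW suf)
          ≡⟨ cong (λ u → DIO (u · shiftW suf)) (·-Shuffle p pair-Shuffle) ⟩
        DIO ((pre ++ pair) · shiftW suf)
          ≡⟨ cong DIO (·-Shuffle (Shuffle-++ p pair-Shuffle) q) ⟩
        DIO ((pre ++ pair) ++ shiftW suf)
          ≡⟨ DIO-Shuffle (Shuffle-++ (Shuffle-++ p pair-Shuffle) q) ⟩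
        twoBlock k (a + 1 + c) (b + 1 + d)
          ≡⟨ cong₂ (twoBlock k) (one-plus a c) (one-plus b d) ⟩
        twoBlock k (suc (a + c)) (suc (b + d))
          ∎

  Dword-lows : ∀ k a b i m → i + m ≡ b
    → All (Child k a b ∘ word) (Dword (twoBlock k a i) (replicate m (x k)))
  Dword-lows k a b i zero _ = []
  Dword-lows k a b i (suc m) i+1+m≡b =
    subst (All (Child k a b ∘ word))
          (sym (Dword-step (twoBlock-Shuffle k a i) (shiftW-lows-Shuffle k m)))
          (by-one ∷ by-pair ∷ later)
    where
      e : suc (i + m) ≡ b
      e = trans (sym (+-suc i m)) i+1+m≡b
      by-one : Child k a b (twoBlock k (a + m) (i + 0))
      by-one = subst (λ i′ → Child k a b (twoBlock k (a + m) i′)) (sym (+-identityʳ i))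
                     (low-one i m e)
      by-pair : Child k a b (twoBlock k (suc (a + m)) (suc (i + 0)))
      by-pair = subst (λ i′ → Child k a b (twoBlock k (suc (a + m)) (suc i′))) (sym (+-identityʳ i))
                      (low-pair i m e)
      later : All (Child k a b ∘ word) (Dword (twoBlock k a i ++ x k ∷ []) (replicate m (x k)))
      later = subst (λ pre → All (Child k a b ∘ word) (Dword pre (replicate m (x k))))
                    (sym (twoBlock-snoc-low k a i)) (Dword-lows k a b (suc i) m e)

  Dword-highs : ∀ k a b i m → i + m ≡ a
    → All (Child k a b ∘ word) (Dword (twoBlock k i 0) (twoBlock k m b))
  Dword-highs k a b i zero i+0≡a =
    subst (λ i′ → All (Child k a b ∘ word) (Dword (twoBlock k i′ 0) (replicate b (x k))))
          (sym (trans (sym (+-identityʳ i)) i+0≡a))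
          (Dword-lows k a b 0 b refl)
  Dword-highs k a b i (suc m) i+1+m≡a =
    subst (All (Child k a b ∘ word))
          (sym (Dword-step (highs-Shuffle k i) (shiftW-Shuffle (twoBlock-Shuffle k m b))))
          (high-one i m e ∷ high-pair i m e ∷ later)
    where
      e : suc (i + m) ≡ a
      e = trans (sym (+-suc i m)) i+1+m≡a
      later : All (Child k a b ∘ word) (Dword (twoBlock k i 0 ++ x (suc k) ∷ []) (twoBlock k m b))
      later = subst (λ pre → All (Child k a b ∘ word) (Dword pre (twoBlock k m b)))
                    (sym (twoBlock-snoc-high k i)) (Dword-highs k a b (suc i) m e)

  Dword-twoBlock : ∀ k a b → All (Child k a b ∘ word) (Dword [] (twoBlock k a b))
  Dword-twoBlock k a b = Dword-highs k a b 0 a refl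

  Dword-Forms : ∀ p w → Forms (2 + p) w → All (Forms (3 + p) ∘ word) (Dword [] w)
  Dword-Forms p w (inj₁ refl) = All.map (FormI-children p) (Dword-twoBlock (suc p) 1 (2 + p))
  Dword-Forms p w (inj₂ (inj₁ refl)) = All.map (FormII-children p) (Dword-twoBlock 0 (2 + p) 1)
  Dword-Forms p w (inj₂ (inj₂ (a , b , j , _ , _ , 1≤j , j≤p , a+b≤ , even , refl))) =
    All.map (FormIII-children j a b (a+b≤ , even) 1≤j j≤p) (Dword-twoBlock j a b)

  D-All : ∀ {P Q : Word → Set} → (∀ w → P w → All (Q ∘ word) (Dword [] w))
    → ∀ {e} → All (P ∘ word) e → All (Q ∘ word) (D e)
  D-All f h = concat⁺ (map⁺ (All.map (λ {t} pt → map⁺ (f (word t) pt)) h))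

  Forms₃ : ∀ a b {a≤3 : True (a ≤? 3)} {b≤3 : True (b ≤? 3)} {a+b≤4 : True (a + b ≤? 4)}
    {even : True (2 ∣? (a + b + 4))} → Forms 3 (twoBlock 1 a b)
  Forms₃ a b {a≤3} {b≤3} {a+b≤4} {even} =
    inj₂ (inj₂ (a , b , 1 , toWitness a≤3 , toWitness b≤3 , ≤-refl , ≤-refl ,
                toWitness a+b≤4 , toWitness even , refl))

  D³x₀-Forms : All (Forms 3 ∘ word) (D^ 3 x₀)
  D³x₀-Forms =
    Forms₃ 0 0 ∷ Forms₃ 1 1 ∷ Forms₃ 2 0 ∷ inj₁ refl ∷
    Forms₃ 2 0 ∷ Forms₃ 3 1 ∷ Forms₃ 1 1 ∷ Forms₃ 2 2 ∷
    Forms₃ 0 0 ∷ Forms₃ 1 1 ∷ Forms₃ 1 1 ∷ Forms₃ 2 2 ∷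
    Forms₃ 0 2 ∷ Forms₃ 1 3 ∷ Forms₃ 0 2 ∷ inj₂ (inj₁ refl) ∷ []

  D^x₀-Forms : ∀ m → All (Forms (3 + m) ∘ word) (D^ (3 + m) x₀)
  D^x₀-Forms zero = D³x₀-Forms
  D^x₀-Forms (suc m) = D-All (Dword-Forms (suc m)) (D^x₀-Forms m)

  occurs : ∀ k w e → ¬ (coeff k w e ≈ 0#) → Any ((_≡ w) ∘ word) e
  occurs k w [] nonzero = ⊥-elim (nonzero ≈-refl)
  occurs k w (tm a j u ∷ e) nonzero with j ≡ᵇ k | u ==W w in u≟w
  ... | true  | true  = here (==W-sound u w u≟w)
  ... | true  | false = there (occurs k w e nonzero)
  ... | false | _     = there (occurs k w e nonzero)

  All-Appears : ∀ {P : Word → Set} {e w} → All (P ∘ word) e → Appears w e → P w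
  All-Appears {P} {e} {w} all (k , nonzero) with All.lookupAny all (occurs k w e nonzero)
  ... | pw , is-w = subst P is-w pw

proposition3p8 : ∀ {c ℓ} (K : CommutativeRing c ℓ) → Alg.CharZero K
    → (n : ℕ) → 3 ≤ n → (w : Word)
    → Alg.Appears K w (Alg.D^ K n (Alg.x₀ K))
    → ExactlyOne n w
proposition3p8 K _ .(3 + m) (s≤s (s≤s (s≤s {n = m} z≤n))) w appears =
  Forms⇒ExactlyOne (suc m) w (All-Appears (D^x₀-Forms m) appears)
  where open Derivative K
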